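{- The VC-density of the edge relation on the class $\mathcal{H}=\{H(d,q): d,q\in\mathbb{N}\}$ of all Hamming graphs is $2$.
   Context: For $d,q\in\mathbb{N}$ and a set $S$ with $|S|=q$, the Hamming graph $H(d,q)$ has vertex set $S^d$, two vertices being adjacent iff they agree in all but exactly one coordinate. For a graph $G$, the set system of the edge relation is $(V(G),\{N(v):v\in V(G)\})$, $N(v)$ the open neighbourhood. For a set system $(X,\mathcal{S})$ the shatter function is $\pi_{\mathcal{S}}(n)=\max\{|\{S\cap A: S\in\mathcal{S}\}| : A\subseteq X, |A|=n\}$; $A$ is shattered if $\{S\cap A:S\in\mathcal{S}\}=\mathcal{P}(A)$, and the VC-dimension is the supremum of sizes of shattered sets. For a class $\mathcal{C}$ of set systems, $\mathrm{VC}(\mathcal{C})$ is the supremum of the VC-dimensions of its members, $\pi_{\mathcal{C}}(n)=\max\{\pi_{\mathcal{S}}(n):(X,\mathcal{S})\in\mathcal{C}\}$, and $\mathrm{vc}(\mathcal{C})=\inf\{r\in\mathbb{R}^+:\pi_{\mathcal{C}}(n)\in\mathcal{O}(n^r)\}$ if $\mathrm{VC}(\mathcal{C})<\infty$, and $\infty$ otherwise.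
   Formalization: The exponent r in the definition of $\mathrm{vc}(\mathcal{C})$ ranges over the positive rationals instead of $\mathbb{R}^+$. -}

module Defs where

open import Data.Nat using (ℕ; zero; suc; _+_; _*_; _^_; _≤_; _<_; _≡ᵇ_)
open import Data.Bool using (Bool; true; false; if_then_else_)
open import Data.Fin using (Fin)
open import Data.Fin.Properties using () renaming (_≟_ to _≟ᶠ_)
open import Data.Vec using (Vec; []; _∷_; lookup; map; zipWith)
open import Data.Vec.Properties using (≡-dec)
open import Data.List using (List; []; _∷_; length; filter; concatMap; allFin)
import Data.List as L
open import Data.List.Relation.Unary.Any using (any?)
open import Data.Bool.Properties using () renaming (_≟_ to _≟ᵇ_)
open import Relation.Nullary using (Dec; yes; no; does)
open import Relation.Binary.PropositionalEquality using (_≡_)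
open import Data.Product using (Σ; ∃; _×_)

allVecs : {A : Set} → List A → (d : ℕ) → List (Vec A d)
allVecs xs zero    = [] ∷ []
allVecs xs (suc d) = concatMap (λ x → L.map (x ∷_) (allVecs xs d)) xs

-- Vertices of the Hamming graph H(d,q): words of length d over S = Fin q.
Vertex : ℕ → ℕ → Set
Vertex d q = Vec (Fin q) d

vertices : (d q : ℕ) → List (Vertex d q)
vertices d q = allVecs (allFin q) d

hammingDist : {d q : ℕ} → Vertex d q → Vertex d q → ℕ
hammingDist []       []       = 0
hammingDist (x ∷ u) (y ∷ v) = (if does (x ≟ᶠ y) then 0 else 1) + hammingDist u v

adj : {d q : ℕ} → Vertex d q → Vertex d q → Bool
adj u v = hammingDist u v ≡ᵇ 1

-- A subset of an n-element set A = (a₀,…,a_{n-1}) as a characteristic vector.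
Trace : ℕ → Set
Trace n = Vec Bool n

-- N(v) ∩ A, encoded as characteristic vector w.r.t. the enumeration A.
trace : {d q n : ℕ} → Vec (Vertex d q) n → Vertex d q → Trace n
trace A v = map (adj v) A

-- Distinct n-element subsets A of V(H(d,q)), given by an injective enumeration.
DistinctVec : {X : Set} {n : ℕ} → Vec X n → Set
DistinctVec {n = n} A = (i j : Fin n) → lookup A i ≡ lookup A j → i ≡ j

numTraces : (d q n : ℕ) → Vec (Vertex d q) n → ℕ
numTraces d q n A =
  length (filter (λ T → any? (λ v → ≡-dec _≟ᵇ_ (trace A v) T) (vertices d q))
                 (allVecs (true ∷ false ∷ []) n))

Shattered : (d q n : ℕ) → Vec (Vertex d q) n → Set
Shattered d q n A = (T : Trace n) → ∃ λ v → trace A v ≡ T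

FiniteVC : Set
FiniteVC = ∃ λ k → (d q n : ℕ) (A : Vec (Vertex d q) n) → DistinctVec A →
  Shattered d q n A → n ≤ k

-- π_𝓗(n) ∈ O(n^(a/b)) (b > 0), with both sides raised to the b-th power:
-- ∃ K N, ∀ n ≥ N, ∀ d q, ∀ A ⊆ V(H(d,q)) with |A| = n : |traces|^b ≤ K·n^a.
BigORat : (a b : ℕ) → Set
BigORat a b = ∃ λ K → ∃ λ N → (n : ℕ) → N ≤ n → (d q : ℕ) →
  (A : Vec (Vertex d q) n) → DistinctVec A → numTraces d q n A ^ b ≤ K * n ^ a

-- vc(𝓗) = 2 : VC(𝓗) finite, π ∈ O(n^r) for every rational r > 2 and for no
-- positive rational r < 2 (the set of admissible r is upward closed).
VCDensityTwo : Set
VCDensityTwo = FiniteVC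
  × ((a b : ℕ) → 0 < b → 2 * b < a → BigORat a b)
  × ((a b : ℕ) → 0 < b → 0 < a → a < 2 * b → BigORat a b → Data.Empty.⊥)
  where import Data.Empty

-- Let v be a vertex outside A with two neighbours in A. If two of its neighbours
-- are at distance 2, v is one of their two common neighbours, which are obtained from them by a
-- crossover. Otherwise its neighbours a_i, a_j, ... in A are pairwise adjacent, and N(v) ∩ A is
-- the set of points of A within distance 1 of both a_i and a_j: these points lie on the line of
-- the Hamming graph through a_i and a_j, which is a clique. So every trace N(v) ∩ A is read off
-- from at most two points of A in one of four ways or is empty, whence π(n) ≤ 1 + 4n² ≤ 5n², and
-- as 2^n > 1 + 4n² for n ≥ 9 no set of more than 8 vertices is shattered. In H(2, m+1) the 2m points (i, 0) and (0, j) with i, j ≠ 0 receive m² distinct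
-- traces from the points (i, j), so π(2m) ≥ m² and π is not O(n^r) for any r < 2.

module Submission where

open import Defs
open import Data.Bool using (Bool; true; false; if_then_else_)
open import Data.Bool.Properties using () renaming (_≟_ to _≟ᵇ_)
open import Data.Empty using (⊥)
open import Data.Fin using (Fin; zero; suc; splitAt; join)
open import Data.Fin.Properties using (any?; splitAt-join; join-splitAt) renaming (_≟_ to _≟ᶠ_)
open import Data.List using (List; []; _∷_; length; _++_; filter; concatMap; cartesianProductWith; cartesianProduct; allFin)
import Data.List as List
open import Data.List.Properties using (length-++; length-map; length-tabulate)
open import Data.List.Membership.Propositional using (_∈_)
open import Data.List.Membership.Propositional.Properties
  using (∈-∃++; ∈-++⁺ˡ; ∈-++⁺ʳ; ∈-++⁻; ∈-map⁻; ∈-filter⁺; ∈-filter⁻; ∈-allFin; ∈-cartesianProductWith⁺; ∈-cartesianProduct⁺)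
open import Data.List.Relation.Binary.Subset.Propositional using (_⊆_)
open import Data.List.Relation.Unary.All as All using ([]; _∷_)
open import Data.List.Relation.Unary.Any using (Any; here; there; satisfied)
import Data.List.Relation.Unary.Any as Any
open import Data.List.Relation.Unary.Unique.Propositional using (Unique; []; _∷_)
import Data.List.Relation.Unary.Unique.Propositional.Properties as Unique
open import Data.Nat using (ℕ; zero; suc; _+_; _*_; _^_; _≤_; _<_; z≤n; s≤s; s≤s⁻¹; z<s; _≤?_; _<?_; NonZero; >-nonZero)
open import Data.Nat.Properties
  using ( ≤-refl; ≤-trans; ≤-reflexive; ≤-antisym; <⇒≤; <⇒≱; ≰⇒>; ≤∧≢⇒<; n≢0⇒n>0; n≤0⇒n≡0; 0≢1+n
        ; suc-injective; +-suc; +-identityʳ; *-identityʳ; *-assoc; m≤m+n; m≤n+m; m<m+n; m≤n⇒∃[o]m+o≡n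
        ; +-mono-≤; +-monoˡ-≤; *-mono-≤; *-monoʳ-≤; *-cancelʳ-≤; ^-monoˡ-≤; ^-monoʳ-≤; ^-*-assoc; m^n≢0
        ; +-commutativeSemigroup; *-commutativeSemigroup; module ≤-Reasoning)
  renaming (_≟_ to _≟ℕ_)
open import Algebra.Properties.CommutativeSemigroup +-commutativeSemigroup using ()
  renaming (interchange to +-interchange)
open import Algebra.Properties.CommutativeSemigroup *-commutativeSemigroup using ()
  renaming (interchange to *-interchange)
open import Data.Nat.Tactic.RingSolver using (solve-∀)
open import Data.Product using (∃; _×_; _,_; proj₂)
open import Data.Sum using (_⊎_; inj₁; inj₂)
import Data.Sum as Sum
open import Data.Vec using (Vec; []; _∷_; lookup; tabulate; map)
open import Data.Vec.Properties using (≡-dec; ∷-injective; lookup∘tabulate; tabulate∘lookup; tabulate-cong; lookup-map)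
open import Function using (_$_; _∘_; id)
open import Function.Bundles using (mk⇔)
open import Relation.Nullary using (¬_; Dec; yes; no; does; contradiction)
open import Relation.Nullary.Decidable using (¬?; _×-dec_; dec-false; does-⇔; toWitness)
open import Relation.Binary.PropositionalEquality

private variable d q : ℕ

length-cartesianProductWith : {A B C : Set} (f : A → B → C) (xs : List A) (ys : List B) →
  length (cartesianProductWith f xs ys) ≡ length xs * length ys
length-cartesianProductWith f []       ys = refl
length-cartesianProductWith f (x ∷ xs) ys = begin
  length (List.map (f x) ys ++ cartesianProductWith f xs ys)
    ≡⟨ length-++ (List.map (f x) ys) ⟩
  length (List.map (f x) ys) + length (cartesianProductWith f xs ys)
    ≡⟨ cong₂ _+_ (length-map (f x) ys) (length-cartesianProductWith f xs ys) ⟩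
  length ys + length xs * length ys ∎
  where open ≡-Reasoning

Unique-⊆⇒length-≤ : {A : Set} {xs ys : List A} → Unique xs → xs ⊆ ys → length xs ≤ length ys
Unique-⊆⇒length-≤ {xs = []}     _            _   = z≤n
Unique-⊆⇒length-≤ {xs = x ∷ xs} (x∉xs ∷ xs!) xs⊆ with ∈-∃++ (xs⊆ (here refl))
... | ys₁ , ys₂ , refl = ≤-trans (s≤s (Unique-⊆⇒length-≤ xs! xs⊆ys₁ys₂)) (≤-reflexive length-drop-x)
  where
  xs⊆ys₁ys₂ : xs ⊆ ys₁ ++ ys₂
  xs⊆ys₁ys₂ {y} y∈xs with ∈-++⁻ ys₁ (xs⊆ (there y∈xs))
  ... | inj₁ y∈ys₁         = ∈-++⁺ˡ y∈ys₁
  ... | inj₂ (here refl)   = contradiction refl (All.lookup x∉xs y∈xs)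
  ... | inj₂ (there y∈ys₂) = ∈-++⁺ʳ ys₁ y∈ys₂
  length-drop-x : suc (length (ys₁ ++ ys₂)) ≡ length (ys₁ ++ x ∷ ys₂)
  length-drop-x = begin
    suc (length (ys₁ ++ ys₂))       ≡⟨ cong suc (length-++ ys₁) ⟩
    suc (length ys₁ + length ys₂)   ≡⟨ sym (+-suc (length ys₁) (length ys₂)) ⟩
    length ys₁ + length (x ∷ ys₂)   ≡⟨ sym (length-++ ys₁) ⟩
    length (ys₁ ++ x ∷ ys₂)         ∎
    where open ≡-Reasoning

concatMap-map≡cartesianProductWith : {A B C : Set} (f : A → B → C) (xs : List A) (ys : List B) →
  concatMap (λ x → List.map (f x) ys) xs ≡ cartesianProductWith f xs ys
concatMap-map≡cartesianProductWith f []       ys = refl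
concatMap-map≡cartesianProductWith f (x ∷ xs) ys =
  cong (List.map (f x) ys ++_) (concatMap-map≡cartesianProductWith f xs ys)

allVecs-suc : {A : Set} (xs : List A) (d : ℕ) →
  allVecs xs (suc d) ≡ cartesianProductWith _∷_ xs (allVecs xs d)
allVecs-suc xs d = concatMap-map≡cartesianProductWith _∷_ xs (allVecs xs d)

length-allVecs : {A : Set} (xs : List A) (d : ℕ) → length (allVecs xs d) ≡ length xs ^ d
length-allVecs xs zero    = refl
length-allVecs xs (suc d) = begin
  length (allVecs xs (suc d))                                  ≡⟨ cong length (allVecs-suc xs d) ⟩
  length (cartesianProductWith _∷_ xs (allVecs xs d)) ≡⟨ length-cartesianProductWith _ xs _ ⟩
  length xs * length (allVecs xs d)                            ≡⟨ cong (length xs *_) (length-allVecs xs d) ⟩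
  length xs * length xs ^ d                                    ∎
  where open ≡-Reasoning

∈-allVecs : {A : Set} {xs : List A} → (∀ x → x ∈ xs) → {d : ℕ} (w : Vec A d) → w ∈ allVecs xs d
∈-allVecs ∈xs []             = here refl
∈-allVecs {xs = xs} ∈xs {suc d} (x ∷ w) =
  subst ((x ∷ w) ∈_) (sym (allVecs-suc xs d))
        (∈-cartesianProductWith⁺ _∷_ (∈xs x) (∈-allVecs ∈xs w))

allVecs-unique : {A : Set} {xs : List A} → Unique xs → (d : ℕ) → Unique (allVecs xs d)
allVecs-unique xs! zero    = [] ∷ []
allVecs-unique {xs = xs} xs! (suc d) =
  subst Unique (sym (allVecs-suc xs d))
        (Unique.cartesianProductWith⁺ _∷_ ∷-injective xs! (allVecs-unique xs! d))

-- Hamming distance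

-- hammingDist (x ∷ u) (y ∷ v) unfolds to coordDist x y + hammingDist u v.
coordDist : Fin q → Fin q → ℕ
coordDist x y = if does (x ≟ᶠ y) then 0 else 1

coordDist-sym : (x y : Fin q) → coordDist x y ≡ coordDist y x
coordDist-sym x y with x ≟ᶠ y | y ≟ᶠ x
... | yes _   | yes _   = refl
... | no _    | no _    = refl
... | yes x≡y | no y≢x  = contradiction (sym x≡y) y≢x
... | no x≢y  | yes y≡x = contradiction (sym y≡x) x≢y

coordDist-triangle : (x y z : Fin q) → coordDist x z ≤ coordDist x y + coordDist y z
coordDist-triangle x y z with x ≟ᶠ z | x ≟ᶠ y | y ≟ᶠ z
... | yes _   | _        | _        = z≤n
... | no x≢z  | yes refl | yes refl = contradiction refl x≢z
... | no _    | yes _    | no _     = ≤-refl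
... | no _    | no _     | _        = s≤s z≤n

hammingDist-self : (u : Vertex d q) → hammingDist u u ≡ 0
hammingDist-self []      = refl
hammingDist-self (x ∷ u) with x ≟ᶠ x
... | yes _   = hammingDist-self u
... | no x≢x  = contradiction refl x≢x

hammingDist-sym : (u v : Vertex d q) → hammingDist u v ≡ hammingDist v u
hammingDist-sym []      []      = refl
hammingDist-sym (x ∷ u) (y ∷ v) = cong₂ _+_ (coordDist-sym x y) (hammingDist-sym u v)

hammingDist≡0⇒≡ : (u v : Vertex d q) → hammingDist u v ≡ 0 → u ≡ v
hammingDist≡0⇒≡ []      []      _ = refl
hammingDist≡0⇒≡ (x ∷ u) (y ∷ v) h with x ≟ᶠ y
... | yes refl = cong (x ∷_) (hammingDist≡0⇒≡ u v h)

hammingDist-triangle : (u v w : Vertex d q) → hammingDist u w ≤ hammingDist u v + hammingDist v w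
hammingDist-triangle []      []      []      = z≤n
hammingDist-triangle (x ∷ u) (y ∷ v) (z ∷ w) =
  ≤-trans (+-mono-≤ (coordDist-triangle x y z) (hammingDist-triangle u v w))
          (≤-reflexive (+-interchange (coordDist x y) (coordDist y z) (hammingDist u v) (hammingDist v w)))

hammingDist≡suc⇒≢ : {u v : Vertex d q} {k : ℕ} → hammingDist u v ≡ suc k → u ≢ v
hammingDist≡suc⇒≢ {u = u} uv refl = 0≢1+n (trans (sym (hammingDist-self u)) uv)

∷-≡suc⁻ : (x y : Fin q) (u v : Vertex d q) {k : ℕ} → hammingDist (x ∷ u) (y ∷ v) ≡ suc k →
  (x ≡ y × hammingDist u v ≡ suc k) ⊎ (x ≢ y × hammingDist u v ≡ k)
∷-≡suc⁻ x y u v h with x ≟ᶠ y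
... | yes x≡y = inj₁ (x≡y , h)
... | no x≢y  = inj₂ (x≢y , suc-injective h)

∷-≤1⁻ : (x y : Fin q) (u v : Vertex d q) → hammingDist (x ∷ u) (y ∷ v) ≤ 1 →
  (x ≡ y × hammingDist u v ≤ 1) ⊎ (x ≢ y × u ≡ v)
∷-≤1⁻ x y u v h with x ≟ᶠ y
... | yes x≡y = inj₁ (x≡y , h)
... | no x≢y  = inj₂ (x≢y , hammingDist≡0⇒≡ u v (n≤0⇒n≡0 (s≤s⁻¹ h)))

hammingDist-∷-same : (x : Fin q) (u v : Vertex d q) → hammingDist (x ∷ u) (x ∷ v) ≡ hammingDist u v
hammingDist-∷-same x u v with x ≟ᶠ x
... | yes _  = refl
... | no x≢x = contradiction refl x≢x

hammingDist-∷-≤1 : (x y : Fin q) (u : Vertex d q) → hammingDist (x ∷ u) (y ∷ u) ≤ 1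
hammingDist-∷-≤1 x y u rewrite hammingDist-self u with x ≟ᶠ y
... | yes _ = z≤n
... | no _  = ≤-refl

neighbours-within-2 : (v x y : Vertex d q) → hammingDist v x ≡ 1 → hammingDist v y ≡ 1 →
  hammingDist x y ≤ 2
neighbours-within-2 v x y vx vy =
  ≤-trans (hammingDist-triangle x v y) (≤-reflexive (cong₂ _+_ (trans (hammingDist-sym x v) vx) vy))

crossover : Vertex d q → Vertex d q → Vertex d q
crossover []      []      = []
crossover (x ∷ u) (y ∷ v) = if does (x ≟ᶠ y) then x ∷ crossover u v else y ∷ u

crossover-∷-≡ : (x : Fin q) (u v : Vertex d q) → crossover (x ∷ u) (x ∷ v) ≡ x ∷ crossover u v
crossover-∷-≡ x u v with x ≟ᶠ x
... | yes _   = refl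
... | no x≢x  = contradiction refl x≢x

crossover-∷-≢ : {x y : Fin q} → x ≢ y → (u v : Vertex d q) → crossover (x ∷ u) (y ∷ v) ≡ y ∷ u
crossover-∷-≢ {x = x} {y} x≢y u v with x ≟ᶠ y
... | yes x≡y = contradiction x≡y x≢y
... | no _    = refl

commonNeighbour-at-distance-2 : (v x y : Vertex d q) → hammingDist v x ≡ 1 → hammingDist v y ≡ 1 →
  hammingDist x y ≡ 2 → v ≡ crossover x y ⊎ v ≡ crossover y x
commonNeighbour-at-distance-2 []      []      []      () _  _
commonNeighbour-at-distance-2 (a ∷ v) (b ∷ x) (c ∷ y) vx vy xy
  with ∷-≡suc⁻ b c x y xy | ∷-≡suc⁻ a b v x vx | ∷-≡suc⁻ a c v y vy
... | inj₁ (refl , xy′) | inj₁ (refl , vx′) | inj₁ (_ , vy′) =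
  Sum.map (λ v≡ → trans (cong (a ∷_) v≡) (sym (crossover-∷-≡ a x y)))
          (λ v≡ → trans (cong (a ∷_) v≡) (sym (crossover-∷-≡ a y x)))
          (commonNeighbour-at-distance-2 v x y vx′ vy′ xy′)
... | inj₁ (refl , _)   | inj₁ (refl , _)   | inj₂ (a≢b , _) = contradiction refl a≢b
... | inj₁ (refl , _)   | inj₂ (a≢b , _)   | inj₁ (refl , _) = contradiction refl a≢b
... | inj₁ (refl , xy′) | inj₂ (_ , vx′)    | inj₂ (_ , vy′) =
  contradiction (trans (sym (hammingDist≡0⇒≡ v x vx′)) (hammingDist≡0⇒≡ v y vy′)) (hammingDist≡suc⇒≢ xy′)
... | inj₂ (b≢c , _)    | inj₁ (refl , _)   | inj₁ (refl , _) = contradiction refl b≢c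
... | inj₂ (b≢c , _)    | inj₁ (refl , _)   | inj₂ (_ , vy′) =
  inj₂ (trans (cong (a ∷_) (hammingDist≡0⇒≡ v y vy′)) (sym (crossover-∷-≢ (b≢c ∘ sym) y x)))
... | inj₂ (b≢c , _)    | inj₂ (_ , vx′)    | inj₁ (refl , _) =
  inj₁ (trans (cong (a ∷_) (hammingDist≡0⇒≡ v x vx′)) (sym (crossover-∷-≢ b≢c x y)))
... | inj₂ (_ , xy′)    | inj₂ (_ , vx′)    | inj₂ (_ , vy′) =
  contradiction (trans (sym (hammingDist≡0⇒≡ v x vx′)) (hammingDist≡0⇒≡ v y vy′)) (hammingDist≡suc⇒≢ xy′)

private
  headsAgree : (e b : Fin q) (z x y : Vertex d q) → x ≢ y →
    hammingDist (e ∷ z) (b ∷ x) ≤ 1 → hammingDist (e ∷ z) (b ∷ y) ≤ 1 →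
    e ≡ b × hammingDist z x ≤ 1 × hammingDist z y ≤ 1
  headsAgree e b z x y x≢y zx zy with ∷-≤1⁻ e b z x zx | ∷-≤1⁻ e b z y zy
  ... | inj₁ (e≡b , zx′) | inj₁ (_ , zy′)   = e≡b , zx′ , zy′
  ... | inj₁ (e≡b , _)   | inj₂ (e≢b , _)   = contradiction e≡b e≢b
  ... | inj₂ (e≢b , _)   | inj₁ (e≡b , _)   = contradiction e≡b e≢b
  ... | inj₂ (_ , z≡x)   | inj₂ (_ , z≡y)   = contradiction (trans (sym z≡x) z≡y) x≢y

  tailsAgree : (e b c : Fin q) (z x : Vertex d q) → b ≢ c →
    hammingDist (e ∷ z) (b ∷ x) ≤ 1 → hammingDist (e ∷ z) (c ∷ x) ≤ 1 → z ≡ x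
  tailsAgree e b c z x b≢c zx zy with ∷-≤1⁻ e b z x zx | ∷-≤1⁻ e c z x zy
  ... | inj₂ (_ , z≡x)    | _                 = z≡x
  ... | inj₁ _            | inj₂ (_ , z≡x)    = z≡x
  ... | inj₁ (refl , _)   | inj₁ (refl , _)   = contradiction refl b≢c

commonClosedNeighbourhood-clique : (x y z w : Vertex d q) → hammingDist x y ≡ 1 →
  hammingDist z x ≤ 1 → hammingDist z y ≤ 1 → hammingDist w x ≤ 1 → hammingDist w y ≤ 1 →
  hammingDist z w ≤ 1
commonClosedNeighbourhood-clique []      []      []      []      () _ _ _ _
commonClosedNeighbourhood-clique (b ∷ x) (c ∷ y) (e ∷ z) (f ∷ w) xy zx zy wx wy
  with ∷-≡suc⁻ b c x y xy
... | inj₁ (refl , xy′)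
  with headsAgree e b z x y (hammingDist≡suc⇒≢ xy′) zx zy | headsAgree f b w x y (hammingDist≡suc⇒≢ xy′) wx wy
... | refl , zx′ , zy′ | refl , wx′ , wy′ =
  subst (_≤ 1) (sym (hammingDist-∷-same e z w)) (commonClosedNeighbourhood-clique x y z w xy′ zx′ zy′ wx′ wy′)
commonClosedNeighbourhood-clique (b ∷ x) (c ∷ y) (e ∷ z) (f ∷ w) xy zx zy wx wy
  | inj₂ (b≢c , xy′) rewrite sym (hammingDist≡0⇒≡ x y xy′)
  | tailsAgree e b c z x b≢c zx zy | tailsAgree f b c w x b≢c wx wy = hammingDist-∷-≤1 e f x

private
  booleans : List Bool
  booleans = true ∷ false ∷ []

  ∈-booleans : (b : Bool) → b ∈ booleans
  ∈-booleans true  = here refl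
  ∈-booleans false = there (here refl)

  booleans-unique : Unique booleans
  booleans-unique = ((λ ()) ∷ []) ∷ [] ∷ []

module _ {d q n : ℕ} (A : Vec (Vertex d q) n) where

  private
    realised? : (T : Trace n) → Dec (Any (λ v → trace A v ≡ T) (vertices d q))
    realised? T = Any.any? (λ v → ≡-dec _≟ᵇ_ (trace A v) T) (vertices d q)

    traces : List (Trace n)
    traces = filter realised? (allVecs booleans n)

    ∈-traces : (v : Vertex d q) → trace A v ∈ traces
    ∈-traces v = ∈-filter⁺ realised? (∈-allVecs ∈-booleans (trace A v))
                   (Any.map (λ v≡w → cong (trace A) (sym v≡w)) (∈-allVecs ∈-allFin v))

  numTraces-≤ : (ts : List (Trace n)) → (∀ v → trace A v ∈ ts) → numTraces d q n A ≤ length ts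
  numTraces-≤ ts ∈ts = Unique-⊆⇒length-≤ (Unique.filter⁺ realised? (allVecs-unique booleans-unique n)) traces⊆ts
    where
    traces⊆ts : ∀ {T} → T ∈ traces → T ∈ ts
    traces⊆ts T∈ with satisfied (proj₂ (∈-filter⁻ realised? {xs = allVecs booleans n} T∈))
    ... | v , refl = ∈ts v

  numTraces-≥ : (ts : List (Trace n)) → Unique ts → (∀ {T} → T ∈ ts → ∃ λ v → trace A v ≡ T) →
    length ts ≤ numTraces d q n A
  numTraces-≥ ts ts! realised = Unique-⊆⇒length-≤ ts! ts⊆traces
    where
    ts⊆traces : ∀ {T} → T ∈ ts → T ∈ traces
    ts⊆traces T∈ with realised T∈
    ... | v , refl = ∈-traces v

  shattered⇒2^n≤numTraces : Shattered d q n A → 2 ^ n ≤ numTraces d q n A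
  shattered⇒2^n≤numTraces sh = ≤-trans (≤-reflexive (sym (length-allVecs booleans n)))
    (numTraces-≥ (allVecs booleans n) (allVecs-unique booleans-unique n) (λ {T} _ → sh T))

-- Canonical traces

module _ {d q n : ℕ} (A : Vec (Vertex d q) n) where

  private
    a : Fin n → Vertex d q
    a = lookup A

  Adjacent : Vertex d q → Fin n → Set
  Adjacent v m = hammingDist v (a m) ≡ 1

  Adjacent? : (v : Vertex d q) (m : Fin n) → Dec (Adjacent v m)
  Adjacent? v m = hammingDist v (a m) ≟ℕ 1

  -- does (Adjacent? v m) unfolds to adj v (a m).
  trace-≡-tabulate : (v : Vertex d q) (f : Fin n → Bool) → (∀ m → does (Adjacent? v m) ≡ f m) →
    trace A v ≡ tabulate f
  trace-≡-tabulate v f adj≡f = begin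
    map (adj v) A                     ≡⟨ sym (tabulate∘lookup (map (adj v) A)) ⟩
    tabulate (lookup (map (adj v) A)) ≡⟨ tabulate-cong (λ m → trans (lookup-map m (adj v) A) (adj≡f m)) ⟩
    tabulate f                        ∎
    where open ≡-Reasoning

  emptyTrace : Trace n
  emptyTrace = tabulate (λ _ → false)

  singletonTrace : Fin n → Trace n
  singletonTrace i = tabulate (λ m → does (m ≟ᶠ i))

  OnLine : Fin n → Fin n → Fin n → Set
  OnLine i j m = hammingDist (a m) (a i) ≤ 1 × hammingDist (a m) (a j) ≤ 1

  OnLine? : (i j m : Fin n) → Dec (OnLine i j m)
  OnLine? i j m = hammingDist (a m) (a i) ≤? 1 ×-dec hammingDist (a m) (a j) ≤? 1

  lineTrace : Fin n → Fin n → Trace n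
  lineTrace i j = tabulate (does ∘ OnLine? i j)

  shapes : List (Fin n × Fin n → Trace n)
  shapes = (λ (i , _) → trace A (a i))
         ∷ (λ (i , _) → singletonTrace i)
         ∷ (λ (i , j) → trace A (crossover (a i) (a j)))
         ∷ (λ (i , j) → lineTrace i j)
         ∷ []

  canonicalTraces : List (Trace n)
  canonicalTraces = emptyTrace ∷ cartesianProductWith _$_ shapes (cartesianProduct (allFin n) (allFin n))

  length-canonicalTraces : length canonicalTraces ≡ 1 + 4 * (n * n)
  length-canonicalTraces = cong suc (begin
    length (cartesianProductWith _$_ shapes (cartesianProduct (allFin n) (allFin n)))
      ≡⟨ length-cartesianProductWith _$_ shapes (cartesianProduct (allFin n) (allFin n)) ⟩
    4 * length (cartesianProduct (allFin n) (allFin n))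
      ≡⟨ cong (4 *_) (length-cartesianProductWith _,_ (allFin n) (allFin n)) ⟩
    4 * (length (allFin n) * length (allFin n))
      ≡⟨ cong (λ k → 4 * (k * k)) (length-tabulate {n = n} id) ⟩
    4 * (n * n) ∎)
    where open ≡-Reasoning

  ∈-canonicalTraces : {s : Fin n × Fin n → Trace n} → s ∈ shapes → (i j : Fin n) →
    s (i , j) ∈ canonicalTraces
  ∈-canonicalTraces s∈ i j =
    there (∈-cartesianProductWith⁺ _$_ s∈ (∈-cartesianProduct⁺ (∈-allFin i) (∈-allFin j)))

  trace-isolated : (v : Vertex d q) → (∀ m → ¬ Adjacent v m) → trace A v ≡ emptyTrace
  trace-isolated v isolated = trace-≡-tabulate v _ (λ m → dec-false (Adjacent? v m) (isolated m))

  trace-pendant : (v : Vertex d q) (i : Fin n) → Adjacent v i → (∀ m → ¬ m ≡ i → ¬ Adjacent v m) →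
    trace A v ≡ singletonTrace i
  trace-pendant v i vi pendant = trace-≡-tabulate v _ (λ m → does-⇔ (mk⇔ to from) (Adjacent? v m) (m ≟ᶠ i))
    where
    to : ∀ {m} → Adjacent v m → m ≡ i
    to {m} vm with m ≟ᶠ i
    ... | yes m≡i = m≡i
    ... | no m≢i  = contradiction vm (pendant m m≢i)
    from : ∀ {m} → m ≡ i → Adjacent v m
    from refl = vi

  trace-line : (v : Vertex d q) (i j : Fin n) → (∀ k → ¬ a k ≡ v) → a i ≢ a j →
    Adjacent v i → Adjacent v j → (∀ k l → Adjacent v k → Adjacent v l → hammingDist (a k) (a l) ≢ 2) →
    trace A v ≡ lineTrace i j
  trace-line v i j v∉A ai≢aj vi vj noFarPair = trace-≡-tabulate v _ (λ m →
    does-⇔ (mk⇔ to from) (Adjacent? v m) (OnLine? i j m))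
    where
    ≤2∧≢2⇒≤1 : ∀ {k} → k ≤ 2 → k ≢ 2 → k ≤ 1
    ≤2∧≢2⇒≤1 k≤2 k≢2 = s≤s⁻¹ (≤∧≢⇒< k≤2 k≢2)
    ai-aj : hammingDist (a i) (a j) ≡ 1
    ai-aj = ≤-antisym (≤2∧≢2⇒≤1 (neighbours-within-2 v (a i) (a j) vi vj) (noFarPair i j vi vj))
                      (n≢0⇒n>0 (ai≢aj ∘ hammingDist≡0⇒≡ (a i) (a j)))
    to : ∀ {m} → Adjacent v m → OnLine i j m
    to {m} vm = ≤2∧≢2⇒≤1 (neighbours-within-2 v (a m) (a i) vm vi) (noFarPair m i vm vi)
              , ≤2∧≢2⇒≤1 (neighbours-within-2 v (a m) (a j) vm vj) (noFarPair m j vm vj)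
    from : ∀ {m} → OnLine i j m → Adjacent v m
    from {m} (mi , mj) = ≤-antisym
      (commonClosedNeighbourhood-clique (a i) (a j) v (a m) ai-aj
        (≤-reflexive vi) (≤-reflexive vj) mi mj)
      (n≢0⇒n>0 (λ vm≡0 → v∉A m (sym (hammingDist≡0⇒≡ v (a m) vm≡0))))

  trace∈canonicalTraces : DistinctVec A → (v : Vertex d q) → trace A v ∈ canonicalTraces
  trace∈canonicalTraces distinct v with any? (λ k → ≡-dec _≟ᶠ_ (a k) v)
  ... | yes (k , refl) = ∈-canonicalTraces (here refl) k k
  ... | no v∉A with any? (Adjacent? v)
  ...   | no isolated = here (trace-isolated v (λ m vm → isolated (m , vm)))
  ...   | yes (i , vi) with any? (λ j → ¬? (j ≟ᶠ i) ×-dec Adjacent? v j)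
  ...     | no pendant =
    subst (_∈ canonicalTraces)
          (sym (trace-pendant v i vi (λ m m≢i vm → pendant (m , m≢i , vm))))
          (∈-canonicalTraces (there (here refl)) i i)
  ...     | yes (j , j≢i , vj)
    with any? (λ k → any? (λ l → Adjacent? v k ×-dec Adjacent? v l ×-dec (hammingDist (a k) (a l) ≟ℕ 2)))
  ...       | no noFarPair =
    subst (_∈ canonicalTraces)
          (sym (trace-line v i j (λ k ak≡v → v∉A (k , ak≡v)) (λ ai≡aj → j≢i (sym (distinct i j ai≡aj))) vi vj
                           (λ k l vk vl kl → noFarPair (k , l , vk , vl , kl))))
          (∈-canonicalTraces (there (there (there (here refl)))) i j)
  ...       | yes (k , l , vk , vl , kl) with commonNeighbour-at-distance-2 v (a k) (a l) vk vl kl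
  ...         | inj₁ refl = ∈-canonicalTraces (there (there (here refl))) k l
  ...         | inj₂ refl = ∈-canonicalTraces (there (there (here refl))) l k

-- Points on the axes of H(2, m+1)

does-≟-refl⇒≡ : {k : ℕ} (x y : Fin k) → does (x ≟ᶠ x) ≡ does (y ≟ᶠ x) → y ≡ x
does-≟-refl⇒≡ x y eq with x ≟ᶠ x | y ≟ᶠ x
... | _      | yes y≡x = y≡x
... | yes _  | no _    = contradiction eq λ ()
... | no x≢x | no _    = contradiction refl x≢x

module Axes (m : ℕ) where

  axisPoint : Fin m ⊎ Fin m → Vertex 2 (suc m)
  axisPoint (inj₁ i) = suc i ∷ zero ∷ []
  axisPoint (inj₂ j) = zero ∷ suc j ∷ []

  axes : Vec (Vertex 2 (suc m)) (m + m)
  axes = tabulate (axisPoint ∘ splitAt m)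

  lookup-axes : (s : Fin m ⊎ Fin m) → lookup axes (join m m s) ≡ axisPoint s
  lookup-axes s = trans (lookup∘tabulate _ (join m m s)) (cong axisPoint (splitAt-join m m s))

  axisPoint-injective : {s s′ : Fin m ⊎ Fin m} → axisPoint s ≡ axisPoint s′ → s ≡ s′
  axisPoint-injective {inj₁ i} {inj₁ .i} refl = refl
  axisPoint-injective {inj₂ j} {inj₂ .j} refl = refl

  axes-distinct : DistinctVec axes
  axes-distinct k k′ eq = begin
    k                       ≡⟨ sym (join-splitAt m m k) ⟩
    join m m (splitAt m k)  ≡⟨ cong (join m m) (axisPoint-injective axisPoints≡) ⟩
    join m m (splitAt m k′) ≡⟨ join-splitAt m m k′ ⟩
    k′                      ∎
    where
    open ≡-Reasoning
    axisPoints≡ : axisPoint (splitAt m k) ≡ axisPoint (splitAt m k′)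
    axisPoints≡ = trans (sym (lookup∘tabulate _ k)) (trans eq (lookup∘tabulate _ k′))

  offAxis : Fin m × Fin m → Vertex 2 (suc m)
  offAxis (i , j) = suc i ∷ suc j ∷ []

  adj-offAxis-inj₁ : (i j i′ : Fin m) → adj (offAxis (i , j)) (axisPoint (inj₁ i′)) ≡ does (i ≟ᶠ i′)
  adj-offAxis-inj₁ i j i′ with does (i ≟ᶠ i′)
  ... | true  = refl
  ... | false = refl

  adj-offAxis-inj₂ : (i j j′ : Fin m) → adj (offAxis (i , j)) (axisPoint (inj₂ j′)) ≡ does (j ≟ᶠ j′)
  adj-offAxis-inj₂ i j j′ with does (j ≟ᶠ j′)
  ... | true  = refl
  ... | false = refl

  adj-axisPoint-≡ : (u u′ : Vertex 2 (suc m)) → trace axes u ≡ trace axes u′ →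
    (s : Fin m ⊎ Fin m) → adj u (axisPoint s) ≡ adj u′ (axisPoint s)
  adj-axisPoint-≡ u u′ eq s = begin
    adj u (axisPoint s)                ≡⟨ cong (adj u) (sym (lookup-axes s)) ⟩
    adj u (lookup axes (join m m s))   ≡⟨ sym (lookup-map (join m m s) (adj u) axes) ⟩
    lookup (trace axes u) (join m m s)  ≡⟨ cong (λ t → lookup t (join m m s)) eq ⟩
    lookup (trace axes u′) (join m m s) ≡⟨ lookup-map (join m m s) (adj u′) axes ⟩
    adj u′ (lookup axes (join m m s))  ≡⟨ cong (adj u′) (lookup-axes s) ⟩
    adj u′ (axisPoint s)               ∎
    where open ≡-Reasoning

  trace-offAxis-injective : {p p′ : Fin m × Fin m} →
    trace axes (offAxis p) ≡ trace axes (offAxis p′) → p ≡ p′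
  trace-offAxis-injective {i , j} {i′ , j′} eq = cong₂ _,_
    (sym (does-≟-refl⇒≡ i i′ (trans (sym (adj-offAxis-inj₁ i j i)) (trans (agree (inj₁ i)) (adj-offAxis-inj₁ i′ j′ i)))))
    (sym (does-≟-refl⇒≡ j j′ (trans (sym (adj-offAxis-inj₂ i j j)) (trans (agree (inj₂ j)) (adj-offAxis-inj₂ i′ j′ j)))))
    where
    agree : (s : Fin m ⊎ Fin m) → adj (offAxis (i , j)) (axisPoint s) ≡ adj (offAxis (i′ , j′)) (axisPoint s)
    agree = adj-axisPoint-≡ (offAxis (i , j)) (offAxis (i′ , j′)) eq

  numTraces-axes : m * m ≤ numTraces 2 (suc m) (m + m) axes
  numTraces-axes = ≤-trans (≤-reflexive (sym length-offAxisTraces))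
    (numTraces-≥ axes offAxisTraces
      (Unique.map⁺ trace-offAxis-injective (Unique.cartesianProduct⁺ (Unique.allFin⁺ m) (Unique.allFin⁺ m)))
      realised)
    where
    pairs : List (Fin m × Fin m)
    pairs = cartesianProduct (allFin m) (allFin m)
    offAxisTraces : List (Trace (m + m))
    offAxisTraces = List.map (trace axes ∘ offAxis) pairs
    length-offAxisTraces : length offAxisTraces ≡ m * m
    length-offAxisTraces = begin
      length offAxisTraces                       ≡⟨ length-map _ pairs ⟩
      length pairs                               ≡⟨ length-cartesianProductWith _,_ (allFin m) (allFin m) ⟩
      length (allFin m) * length (allFin m)      ≡⟨ cong (λ k → k * k) (length-tabulate {n = m} id) ⟩
      m * m                                      ∎
      where open ≡-Reasoning
    realised : ∀ {T} → T ∈ offAxisTraces → ∃ λ v → trace axes v ≡ T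
    realised T∈ with ∈-map⁻ _ T∈
    ... | p , _ , refl = offAxis p , refl

^-distribʳ-* : ∀ m n k → (m * n) ^ k ≡ m ^ k * n ^ k
^-distribʳ-* m n zero    = refl
^-distribʳ-* m n (suc k) = begin
  m * n * (m * n) ^ k      ≡⟨ cong (m * n *_) (^-distribʳ-* m n k) ⟩
  m * n * (m ^ k * n ^ k)  ≡⟨ *-interchange m n (m ^ k) (n ^ k) ⟩
  m * m ^ k * (n * n ^ k)  ∎
  where open ≡-Reasoning

square-^ : ∀ n b → (n * n) ^ b ≡ n ^ (2 * b)
square-^ n b = begin
  (n * n) ^ b      ≡⟨ cong (λ k → (n * k) ^ b) (sym (*-identityʳ n)) ⟩
  (n ^ 2) ^ b      ≡⟨ ^-*-assoc n 2 b ⟩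
  n ^ (2 * b)      ∎
  where open ≡-Reasoning

m^c≤C*m^a⇒m≤C : ∀ m .{{_ : NonZero m}} {a c} C → a < c → m ^ c ≤ C * m ^ a → m ≤ C
m^c≤C*m^a⇒m≤C m {a} C a<c m^c≤ = *-cancelʳ-≤ m C (m ^ a) {{m^n≢0 m a}} (≤-trans (^-monoʳ-≤ m a<c) m^c≤)

quadratic<exponential : ∀ k → 1 + 4 * ((9 + k) * (9 + k)) < 2 ^ (9 + k)
quadratic<exponential zero    = toWitness {a? = 325 <? 512} _
quadratic<exponential (suc k) = begin-strict
  1 + 4 * ((10 + k) * (10 + k))                                  <⟨ m<m+n _ z<s ⟩
  1 + 4 * ((10 + k) * (10 + k)) + (249 + 64 * k + 4 * (k * k))   ≡⟨ sym (doubling k) ⟩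
  2 * (1 + 4 * ((9 + k) * (9 + k)))                              ≤⟨ *-monoʳ-≤ 2 (<⇒≤ (quadratic<exponential k)) ⟩
  2 * 2 ^ (9 + k)                                                ∎
  where
  open ≤-Reasoning
  doubling : ∀ k → 2 * (1 + 4 * ((9 + k) * (9 + k))) ≡ 1 + 4 * ((10 + k) * (10 + k)) + (249 + 64 * k + 4 * (k * k))
  doubling = solve-∀

2^n≤1+4n²⇒n≤8 : ∀ n → 2 ^ n ≤ 1 + 4 * (n * n) → n ≤ 8
2^n≤1+4n²⇒n≤8 n 2^n≤ with n ≤? 8
... | yes n≤8 = n≤8
... | no n≰8 with m≤n⇒∃[o]m+o≡n (≰⇒> n≰8)
...   | k , refl = contradiction 2^n≤ (<⇒≱ (quadratic<exponential k))

numTraces≤1+4n² : (d q n : ℕ) (A : Vec (Vertex d q) n) → DistinctVec A → numTraces d q n A ≤ 1 + 4 * (n * n)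
numTraces≤1+4n² d q n A distinct =
  ≤-trans (numTraces-≤ A (canonicalTraces A) (trace∈canonicalTraces A distinct)) (≤-reflexive (length-canonicalTraces A))

numTraces≤5n² : (d q n : ℕ) (A : Vec (Vertex d q) n) → DistinctVec A → 1 ≤ n → numTraces d q n A ≤ 5 * (n * n)
numTraces≤5n² d q n A distinct 1≤n =
  ≤-trans (numTraces≤1+4n² d q n A distinct) (+-monoˡ-≤ (4 * (n * n)) (*-mono-≤ 1≤n 1≤n))

finiteVC : FiniteVC
finiteVC = 8 , λ d q n A distinct shattered →
  2^n≤1+4n²⇒n≤8 n (≤-trans (shattered⇒2^n≤numTraces A shattered) (numTraces≤1+4n² d q n A distinct))

bigO-above-2 : (a b : ℕ) → 2 * b < a → BigORat a b
bigO-above-2 a b 2b<a = 5 ^ b , 1 , λ n 1≤n d q A distinct → begin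
  numTraces d q n A ^ b   ≤⟨ ^-monoˡ-≤ b (numTraces≤5n² d q n A distinct 1≤n) ⟩
  (5 * (n * n)) ^ b       ≡⟨ ^-distribʳ-* 5 (n * n) b ⟩
  5 ^ b * (n * n) ^ b     ≡⟨ cong (5 ^ b *_) (square-^ n b) ⟩
  5 ^ b * n ^ (2 * b)     ≤⟨ *-monoʳ-≤ (5 ^ b) (^-monoʳ-≤ n {{>-nonZero 1≤n}} (<⇒≤ 2b<a)) ⟩
  5 ^ b * n ^ a           ∎
  where open ≤-Reasoning

¬bigO-below-2 : (a b : ℕ) → a < 2 * b → BigORat a b → ⊥
¬bigO-below-2 a b a<2b (K , N , bound) = <⇒≱ (s≤s (m≤m+n (K * 2 ^ a) N)) (m^c≤C*m^a⇒m≤C m (K * 2 ^ a) a<2b m^2b≤)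
  where
  open Axes
  m : ℕ
  m = suc (K * 2 ^ a + N)
  m^2b≤ : m ^ (2 * b) ≤ K * 2 ^ a * m ^ a
  m^2b≤ = begin
    m ^ (2 * b)                                ≡⟨ sym (square-^ m b) ⟩
    (m * m) ^ b                                ≤⟨ ^-monoˡ-≤ b (numTraces-axes m) ⟩
    numTraces 2 (suc m) (m + m) (axes m) ^ b   ≤⟨ bound (m + m) (≤-trans (m≤n+m N (suc (K * 2 ^ a))) (m≤m+n m m)) 2 (suc m) (axes m) (axes-distinct m) ⟩
    K * (m + m) ^ a                            ≡⟨ cong (λ k → K * (m + k) ^ a) (sym (+-identityʳ m)) ⟩
    K * (2 * m) ^ a                            ≡⟨ cong (K *_) (^-distribʳ-* 2 m a) ⟩
    K * (2 ^ a * m ^ a)                        ≡⟨ sym (*-assoc K (2 ^ a) (m ^ a)) ⟩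
    K * 2 ^ a * m ^ a                          ∎
    where open ≤-Reasoning

mainTheorem6 : VCDensityTwo
mainTheorem6 = finiteVC
             , (λ a b _ 2b<a → bigO-above-2 a b 2b<a)
             , (λ a b _ _ a<2b → ¬bigO-below-2 a b a<2b)
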